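{- Let $n$ be a positive integer and $m=3n$. Let $\Gamma_{m}=\{z\in \mathbb{Z}_3^{m} : \sum_{i=1}^m z_i \equiv 0 \pmod 3\}$, for distinct $i,j\in\{1,\dots,m\}$ let $x_{i,j}\in\mathbb{Z}_3^m$ have $i$th coordinate $1$, $j$th coordinate $2$ and all other coordinates $0$, let $X_m=\{x_{i,j}: i\ne j\}$, and let $G_m$ be the graph on $\Gamma_m$ in which $y,z$ are adjacent iff $y-z\in X_m$. Let $H_{3n}=G_{3n}\square K_3$. Then $H_{3n}^{2n}$ is isomorphic to the lexicographic product $K_{3^{3n-2}}[K_3\square K_3]$.
   Context: $G^k$ is the graph on $V(G)$ in which distinct $u,v$ are adjacent iff their distance in $G$ is at most $k$. The cartesian product $G\square H$ has vertex set $V(G)\times V(H)$, with $(g_1,h_1)$ adjacent to $(g_2,h_2)$ iff either $h_1=h_2$ and $g_1g_2\in E(G)$, or $g_1=g_2$ and $h_1h_2\in E(H)$. The lexicographic product $G[H]$ has vertex set $V(G)\times V(H)$, with $(g_1,h_1)$ adjacent to $(g_2,h_2)$ iff either $g_1g_2\in E(G)$, or $g_1=g_2$ and $h_1h_2\in E(H)$. $K_r$ is the complete graph on $r$ vertices. -}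

module Defs where

open import Level using (0ℓ)
open import Data.Nat using (ℕ; zero; suc; _≤_; _*_; _∸_; _^_)
open import Data.Fin using (Fin; zero; suc)
open import Data.Fin.Properties using (_≟_)
open import Data.Vec using (Vec; tabulate; foldr′; zipWith)
open import Data.Product using (Σ; ∃; ∃-syntax; _×_; _,_)
open import Data.Sum using (_⊎_)
open import Relation.Binary.PropositionalEquality using (_≡_)
open import Relation.Nullary using (¬_; yes; no)
open import Function.Bundles using (_⤖_; Bijection; _⇔_)

record Graph : Set₁ where
  field
    V   : Set
    Adj : V → V → Set
open Graph public

data Walk (G : Graph) : V G → V G → ℕ → Set where
  here : ∀ {u} → Walk G u u 0
  step : ∀ {u w v ℓ} → Adj G u w → Walk G w v ℓ → Walk G u v (suc ℓ)

Dist≤ : (G : Graph) → ℕ → V G → V G → Set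
Dist≤ G k u v = ∃[ ℓ ] (ℓ ≤ k × Walk G u v ℓ)

_^^_ : Graph → ℕ → Graph
G ^^ k = record { V = V G ; Adj = λ u v → ¬ (u ≡ v) × Dist≤ G k u v }

_□_ : Graph → Graph → Graph
G □ H = record
  { V = V G × V H
  ; Adj = λ { (g₁ , h₁) (g₂ , h₂) →
      (h₁ ≡ h₂ × Adj G g₁ g₂) ⊎ (g₁ ≡ g₂ × Adj H h₁ h₂) } }

lex : Graph → Graph → Graph
lex G H = record
  { V = V G × V H
  ; Adj = λ { (g₁ , h₁) (g₂ , h₂) →
      Adj G g₁ g₂ ⊎ (g₁ ≡ g₂ × Adj H h₁ h₂) } }

K : ℕ → Graph
K r = record { V = Fin r ; Adj = λ i j → ¬ (i ≡ j) }

_≅_ : Graph → Graph → Set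
G ≅ H = Σ (V G ⤖ V H) λ f →
  ∀ u v → Adj G u v ⇔ Adj H (Bijection.to f u) (Bijection.to f v)

_+₃_ : Fin 3 → Fin 3 → Fin 3
zero +₃ b = b
suc zero +₃ zero = suc zero
suc zero +₃ suc zero = suc (suc zero)
suc zero +₃ suc (suc zero) = zero
suc (suc zero) +₃ zero = suc (suc zero)
suc (suc zero) +₃ suc zero = zero
suc (suc zero) +₃ suc (suc zero) = suc zero

neg₃ : Fin 3 → Fin 3
neg₃ zero = zero
neg₃ (suc zero) = suc (suc zero)
neg₃ (suc (suc zero)) = suc zero

_-₃_ : Fin 3 → Fin 3 → Fin 3
a -₃ b = a +₃ neg₃ b

sum₃ : ∀ {m} → Vec (Fin 3) m → Fin 3
sum₃ = foldr′ _+₃_ zero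

Γ : ℕ → Set
Γ m = Σ (Vec (Fin 3) m) λ z → sum₃ z ≡ zero

-- x_{i,j}: 1 at i, 2 at j, 0 elsewhere (used only for i ≠ j)
x : ∀ {m} → Fin m → Fin m → Vec (Fin 3) m
x i j = tabulate λ k → f k
  where
  f : _ → Fin 3
  f k with k ≟ i
  ... | yes _ = suc zero
  ... | no _ with k ≟ j
  ...   | yes _ = suc (suc zero)
  ...   | no _ = zero

InX : ∀ {m} → Vec (Fin 3) m → Set
InX {m} d = ∃[ i ] ∃[ j ] (¬ (i ≡ j) × d ≡ x {m} i j)

Gm : ℕ → Graph
Gm m = record
  { V = Γ m
  ; Adj = λ { (y , _) (z , _) → InX (zipWith _-₃_ y z) } }

Hm : ℕ → Graph
Hm m = Gm m □ K 3

-- For vertices y, z of G_m a walk of length ℓ writes w = y − z as a sum of ℓ generators x i j.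
-- For each d the potential Φ d w = Σₖ weight d wₖ drops by at most 3 per generator, and
-- Φ d (d, …, d) = 2m; so a constant nonzero difference needs 2m/3 = 2n generators. Conversely,
-- spending one generator per (𝟙, 𝟚) pair and two per three equal values decomposes any w with
-- zero sum into at most 2|supp w|/3 generators, fewer than 2n unless w is constant and nonzero.
-- Hence in H_m = G_m □ K_3 the distance exceeds 2n exactly between (y, s) and (y + d𝟏, t) with
-- d ≠ 0 and s ≠ t: H_m^{2n} joins all vertices in distinct cosets of ⟨𝟏⟩ in Γ_m (there are
-- 3^{m−2}), and within a coset, with coordinates (y₁, s), it is the rook's graph K_3 □ K_3.

module Submission where

open import Defs
open import Level using (0ℓ)
open import Data.Nat using (ℕ; zero; suc; _+_; _*_; _∸_; _^_; _≤_; _<_; _≤?_; z≤n; s≤s)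
import Data.Nat.Properties as ℕ
open import Data.Nat.Induction using (<-wellFounded)
open import Data.Nat.Tactic.RingSolver using (solve-∀)
open import Data.Fin using (Fin; zero; suc; combine; remQuot)
open import Data.Fin.Properties using (_≟_; all?; any?; suc-injective; combine-remQuot; remQuot-combine)
open import Data.Vec using (Vec; []; _∷_; lookup; tabulate; zipWith; replicate; map; _[_]≔_; head; tail)
open import Data.Vec.Properties
  using (lookup-zipWith; lookup-replicate; lookup-map; lookup∘update; lookup∘update′; lookup∘tabulate;
         tabulate∘lookup; tabulate-cong; map-∘; map-cong; map-id)
open import Data.Product using (∃; _×_; _,_; proj₁; proj₂)
open import Data.Product.Algebra using (×-cong; ×-assoc)
open import Data.Product.Function.NonDependent.Propositional using (_×-⇔_)
open import Data.Sum using (_⊎_; inj₁; inj₂; map₁)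
open import Data.Empty using (⊥-elim)
open import Function using (_∘_)
open import Function.Bundles using (_⇔_; mk⇔; mk↔ₛ′; _↔_; Inverse; Bijection)
open import Function.Properties.Inverse using (↔-refl; ↔-trans; ↔⇒⤖)
open import Function.Properties.Equivalence using () renaming (refl to ⇔-refl; sym to ⇔-sym; trans to ⇔-trans)
open import Function.Related.TypeIsomorphisms using (→-cong-⇔; ¬-cong-⇔)
open import Induction.WellFounded using (Acc; acc)
open import Relation.Binary.PropositionalEquality
open import Relation.Nullary using (¬_; Dec; yes; no; contradiction)
open import Relation.Nullary.Decidable using (from-yes; _→-dec_; _×-dec_; ¬?; decidable-stable)
open import Axiom.UniquenessOfIdentityProofs using (module Decidable⇒UIP)

private variable
  m k : ℕ

pattern 𝟙 = suc zero
pattern 𝟚 = suc (suc zero)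

+₃-comm : ∀ a b → a +₃ b ≡ b +₃ a
+₃-comm = from-yes (all? λ a → all? λ b → a +₃ b ≟ b +₃ a)

+₃-identityʳ : ∀ a → a +₃ zero ≡ a
+₃-identityʳ = from-yes (all? λ a → a +₃ zero ≟ a)

-₃-identityʳ : ∀ a → a -₃ zero ≡ a
-₃-identityʳ = from-yes (all? λ a → a -₃ zero ≟ a)

-₃-self : ∀ a → a -₃ a ≡ zero
-₃-self = from-yes (all? λ a → a -₃ a ≟ zero)

-₃-cancelˡ : ∀ a b → a -₃ (a -₃ b) ≡ b
-₃-cancelˡ = from-yes (all? λ a → all? λ b → a -₃ (a -₃ b) ≟ b)

-₃-+₃-cancel : ∀ a b → (a +₃ b) -₃ b ≡ a
-₃-+₃-cancel = from-yes (all? λ a → all? λ b → (a +₃ b) -₃ b ≟ a)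

+₃--₃-cancel : ∀ a b → (a -₃ b) +₃ b ≡ a
+₃--₃-cancel = from-yes (all? λ a → all? λ b → (a -₃ b) +₃ b ≟ a)

-₃-triangle : ∀ a b c → (a -₃ c) -₃ (a -₃ b) ≡ b -₃ c
-₃-triangle = from-yes (all? λ a → all? λ b → all? λ c → (a -₃ c) -₃ (a -₃ b) ≟ b -₃ c)

-₃-+₃-distrib : ∀ a b c d → (a +₃ b) -₃ (c +₃ d) ≡ (a -₃ c) +₃ (b -₃ d)
-₃-+₃-distrib = from-yes (all? λ a → all? λ b → all? λ c → all? λ d →
  (a +₃ b) -₃ (c +₃ d) ≟ (a -₃ c) +₃ (b -₃ d))

-₃≡0⇒≡ : ∀ a b → a -₃ b ≡ zero → a ≡ b
-₃≡0⇒≡ = from-yes (all? λ a → all? λ b → (a -₃ b ≟ zero) →-dec (a ≟ b))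

-₃-exchange : ∀ a b c d → a -₃ b ≡ c -₃ d → a -₃ c ≡ b -₃ d
-₃-exchange = from-yes (all? λ a → all? λ b → all? λ c → all? λ d →
  (a -₃ b ≟ c -₃ d) →-dec (a -₃ c ≟ b -₃ d))

+₃-thrice : ∀ d s → d +₃ (d +₃ (d +₃ s)) ≡ s
+₃-thrice = from-yes (all? λ d → all? λ s → d +₃ (d +₃ (d +₃ s)) ≟ s)

+₃-cancel-middle : ∀ d e s → d +₃ (e +₃ s) ≡ zero → d +₃ (d +₃ s) ≡ zero → e ≡ d
+₃-cancel-middle = from-yes (all? λ d → all? λ e → all? λ s →
  (d +₃ (e +₃ s) ≟ zero) →-dec (d +₃ (d +₃ s) ≟ zero) →-dec (e ≟ d))

neg₃-solves : ∀ a s → a +₃ (neg₃ (a +₃ s) +₃ s) ≡ zero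
neg₃-solves = from-yes (all? λ a → all? λ s → a +₃ (neg₃ (a +₃ s) +₃ s) ≟ zero)

neg₃-solves-unique : ∀ a b s → a +₃ (b +₃ s) ≡ zero → b ≡ neg₃ (a +₃ s)
neg₃-solves-unique = from-yes (all? λ a → all? λ b → all? λ s →
  (a +₃ (b +₃ s) ≟ zero) →-dec (b ≟ neg₃ (a +₃ s)))

only-zero : ∀ (a : Fin 3) → a ≢ 𝟙 → a ≢ 𝟚 → a ≡ zero
only-zero = from-yes (all? λ (a : Fin 3) → ¬? (a ≟ 𝟙) →-dec ¬? (a ≟ 𝟚) →-dec (a ≟ zero))

only-𝟙 : ∀ (a : Fin 3) → a ≢ zero → a ≢ 𝟚 → a ≡ 𝟙
only-𝟙 = from-yes (all? λ (a : Fin 3) → ¬? (a ≟ zero) →-dec ¬? (a ≟ 𝟚) →-dec (a ≟ 𝟙))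

only-𝟚 : ∀ (a : Fin 3) → a ≢ zero → a ≢ 𝟙 → a ≡ 𝟚
only-𝟚 = from-yes (all? λ (a : Fin 3) → ¬? (a ≟ zero) →-dec ¬? (a ≟ 𝟙) →-dec (a ≟ 𝟚))

Vec₃ : ℕ → Set
Vec₃ = Vec (Fin 3)

infixl 6 _⊖_
_⊖_ : Vec₃ m → Vec₃ m → Vec₃ m
_⊖_ = zipWith _-₃_

Has : Fin 3 → Vec₃ m → Set
Has a w = ∃ λ k → lookup w k ≡ a

has? : ∀ a (w : Vec₃ m) → Dec (Has a w)
has? a w = any? λ k → lookup w k ≟ a

≡-by-lookup : {u v : Vec₃ m} → (∀ k → lookup u k ≡ lookup v k) → u ≡ v
≡-by-lookup {u = u} {v} p = trans (sym (tabulate∘lookup u)) (trans (tabulate-cong p) (tabulate∘lookup v))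

lookup-⊖ : (u v : Vec₃ m) (k : Fin m) → lookup (u ⊖ v) k ≡ lookup u k -₃ lookup v k
lookup-⊖ u v k = lookup-zipWith _-₃_ k u v

⊖-cancelˡ : (u v : Vec₃ m) → u ⊖ (u ⊖ v) ≡ v
⊖-cancelˡ []      []      = refl
⊖-cancelˡ (a ∷ u) (b ∷ v) = cong₂ _∷_ (-₃-cancelˡ a b) (⊖-cancelˡ u v)

⊖-triangle : (u v w : Vec₃ m) → (u ⊖ w) ⊖ (u ⊖ v) ≡ v ⊖ w
⊖-triangle []      []      []      = refl
⊖-triangle (a ∷ u) (b ∷ v) (c ∷ w) = cong₂ _∷_ (-₃-triangle a b c) (⊖-triangle u v w)

⊖≡0⇒≡ : (u v : Vec₃ m) → u ⊖ v ≡ replicate m zero → u ≡ v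
⊖≡0⇒≡ []      []      _  = refl
⊖≡0⇒≡ (a ∷ u) (b ∷ v) eq = cong₂ _∷_ (-₃≡0⇒≡ a b (cong head eq)) (⊖≡0⇒≡ u v (cong tail eq))

zero-or-mixed-or-constant : (w : Vec₃ m) →
  Has zero w ⊎ (Has 𝟙 w × Has 𝟚 w) ⊎ (∃ λ d → d ≢ zero × w ≡ replicate m d)
zero-or-mixed-or-constant w with has? zero w | has? 𝟙 w | has? 𝟚 w
... | yes has0 | _      | _      = inj₁ has0
... | no _     | yes h1 | yes h2 = inj₂ (inj₁ (h1 , h2))
... | no ∄0    | no ∄1  | _      =
  inj₂ (inj₂ (𝟚 , (λ ()) , ≡-by-lookup λ k →
    trans (only-𝟚 _ (∄0 ∘ (k ,_)) (∄1 ∘ (k ,_))) (sym (lookup-replicate k 𝟚))))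
... | no ∄0    | yes _  | no ∄2  =
  inj₂ (inj₂ (𝟙 , (λ ()) , ≡-by-lookup λ k →
    trans (only-𝟙 _ (∄0 ∘ (k ,_)) (∄2 ∘ (k ,_))) (sym (lookup-replicate k 𝟙))))

-- x i j is tabulate of a where-bound function of Defs; lookup-tabulated refl recovers it by unification.
lookup-tabulated : {g : Fin m → Fin 3} {v : Vec₃ m} → v ≡ tabulate g → ∀ k → lookup v k ≡ g k
lookup-tabulated {g = g} refl k = lookup∘tabulate g k

lookup-x-at-i : (i j : Fin m) → lookup (x i j) i ≡ 𝟙
lookup-x-at-i i j with lookup-tabulated {v = x i j} refl i
... | eq with i ≟ i
...   | yes _ = eq
...   | no i≢i = ⊥-elim (i≢i refl)

lookup-x-at-j : (i j : Fin m) → i ≢ j → lookup (x i j) j ≡ 𝟚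
lookup-x-at-j i j i≢j with lookup-tabulated {v = x i j} refl j
... | eq with j ≟ i
...   | yes j≡i = ⊥-elim (i≢j (sym j≡i))
...   | no _ with j ≟ j
...     | yes _ = eq
...     | no j≢j = ⊥-elim (j≢j refl)

lookup-x-elsewhere : (i j k : Fin m) → k ≢ i → k ≢ j → lookup (x i j) k ≡ zero
lookup-x-elsewhere i j k k≢i k≢j with lookup-tabulated {v = x i j} refl k
... | eq with k ≟ i
...   | yes k≡i = ⊥-elim (k≢i k≡i)
...   | no _ with k ≟ j
...     | yes k≡j = ⊥-elim (k≢j k≡j)
...     | no _ = eq

lookup-⊖x-at-i : (w : Vec₃ m) (i j : Fin m) → lookup (w ⊖ x i j) i ≡ lookup w i -₃ 𝟙
lookup-⊖x-at-i w i j = trans (lookup-⊖ w (x i j) i) (cong (lookup w i -₃_) (lookup-x-at-i i j))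

lookup-⊖x-at-j : (w : Vec₃ m) (i j : Fin m) → i ≢ j → lookup (w ⊖ x i j) j ≡ lookup w j -₃ 𝟚
lookup-⊖x-at-j w i j i≢j = trans (lookup-⊖ w (x i j) j) (cong (lookup w j -₃_) (lookup-x-at-j i j i≢j))

lookup-⊖x-elsewhere : (w : Vec₃ m) (i j k : Fin m) → k ≢ i → k ≢ j → lookup (w ⊖ x i j) k ≡ lookup w k
lookup-⊖x-elsewhere w i j k k≢i k≢j =
  trans (lookup-⊖ w (x i j) k) (trans (cong (lookup w k -₃_) (lookup-x-elsewhere i j k k≢i k≢j)) (-₃-identityʳ _))

sum₃-⊖ : (u v : Vec₃ m) → sum₃ (u ⊖ v) ≡ sum₃ u -₃ sum₃ v
sum₃-⊖ []      []      = refl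
sum₃-⊖ (a ∷ u) (b ∷ v) = begin
  (a -₃ b) +₃ sum₃ (u ⊖ v)        ≡⟨ cong ((a -₃ b) +₃_) (sum₃-⊖ u v) ⟩
  (a -₃ b) +₃ (sum₃ u -₃ sum₃ v)  ≡⟨ sym (-₃-+₃-distrib a (sum₃ u) b (sum₃ v)) ⟩
  (a +₃ sum₃ u) -₃ (b +₃ sum₃ v)  ∎
  where open ≡-Reasoning

sum₃-zeros : (w : Vec₃ m) → (∀ k → lookup w k ≡ zero) → sum₃ w ≡ zero
sum₃-zeros []      _     = refl
sum₃-zeros (a ∷ w) zeros rewrite zeros zero = sum₃-zeros w (zeros ∘ suc)

sum₃-single : (w : Vec₃ m) (i : Fin m) → (∀ k → k ≢ i → lookup w k ≡ zero) → sum₃ w ≡ lookup w i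
sum₃-single (a ∷ w) zero zeros =
  trans (cong (a +₃_) (sum₃-zeros w (λ k → zeros (suc k) λ ()))) (+₃-identityʳ a)
sum₃-single (a ∷ w) (suc i) zeros rewrite zeros zero (λ ()) =
  sum₃-single w i (λ k k≢i → zeros (suc k) (k≢i ∘ suc-injective))

sum₃-pair : (w : Vec₃ m) (i j : Fin m) → i ≢ j → (∀ k → k ≢ i → k ≢ j → lookup w k ≡ zero) →
            sum₃ w ≡ lookup w i +₃ lookup w j
sum₃-pair (a ∷ w) zero    zero    i≢j _     = ⊥-elim (i≢j refl)
sum₃-pair (a ∷ w) zero    (suc j) _   zeros =
  cong (a +₃_) (sum₃-single w j (λ k k≢j → zeros (suc k) (λ ()) (k≢j ∘ suc-injective)))
sum₃-pair (a ∷ w) (suc i) zero    _   zeros =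
  trans (cong (a +₃_) (sum₃-single w i (λ k k≢i → zeros (suc k) (k≢i ∘ suc-injective) (λ ()))))
        (+₃-comm a (lookup w i))
sum₃-pair (a ∷ w) (suc i) (suc j) i≢j zeros rewrite zeros zero (λ ()) (λ ()) =
  sum₃-pair w i j (i≢j ∘ cong suc) (λ k k≢i k≢j → zeros (suc k) (k≢i ∘ suc-injective) (k≢j ∘ suc-injective))

sum₃-x : {i j : Fin m} → i ≢ j → sum₃ (x i j) ≡ zero
sum₃-x {i = i} {j} i≢j rewrite sum₃-pair (x i j) i j i≢j (lookup-x-elsewhere i j)
                             | lookup-x-at-i i j | lookup-x-at-j i j i≢j = refl

sum₃-⊖x : (w : Vec₃ m) {i j : Fin m} → i ≢ j → sum₃ w ≡ zero → sum₃ (w ⊖ x i j) ≡ zero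
sum₃-⊖x w {i} {j} i≢j Σw = trans (sum₃-⊖ w (x i j)) (cong₂ _-₃_ Σw (sum₃-x i≢j))

sum₃-replicate-3n : ∀ n d → sum₃ (replicate (3 * n) d) ≡ zero
sum₃-replicate-3n zero    d = refl
sum₃-replicate-3n (suc n) d =
  trans (cong (λ l → sum₃ (replicate l d)) (ℕ.*-suc 3 n)) (trans (+₃-thrice d _) (sum₃-replicate-3n n d))

nonzero-elsewhere : (w : Vec₃ m) (i : Fin m) → sum₃ w ≢ lookup w i → ∃ λ k → k ≢ i × lookup w k ≢ zero
nonzero-elsewhere w i sum≢ with any? (λ k → ¬? (k ≟ i) ×-dec ¬? (lookup w k ≟ zero))
... | yes found = found
... | no none   = ⊥-elim (sum≢ (sum₃-single w i λ k k≢i →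
                    decidable-stable (lookup w k ≟ zero) λ wk≢0 → none (k , k≢i , wk≢0)))

Γ-≡ : {y z : Γ m} → proj₁ y ≡ proj₁ z → y ≡ z
Γ-≡ {y = v , p} {.v , q} refl = cong (v ,_) (Decidable⇒UIP.≡-irrelevant _≟_ p q)

diff : Γ m → Γ m → Vec₃ m
diff y z = proj₁ y ⊖ proj₁ z

sum₃-diff : (y z : Γ m) → sum₃ (diff y z) ≡ zero
sum₃-diff (y , Σy) (z , Σz) = trans (sum₃-⊖ y z) (cong₂ _-₃_ Σy Σz)

_−_ : Γ m → Γ m → Γ m
y − z = diff y z , sum₃-diff y z

X : {i j : Fin m} → i ≢ j → Γ m
X {i = i} {j} i≢j = x i j , sum₃-x i≢j

diff-step : (y y′ z : Γ m) → diff y′ z ≡ diff y z ⊖ diff y y′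
diff-step (y , _) (y′ , _) (z , _) = sym (⊖-triangle y y′ z)

diff-− : (y g : Γ m) → diff y (y − g) ≡ proj₁ g
diff-− (y , _) (g , _) = ⊖-cancelˡ y g

walk-□ˡ : {G H : Graph} {g g′ : V G} {h : V H} {ℓ : ℕ} → Walk G g g′ ℓ → Walk (G □ H) (g , h) (g′ , h) ℓ
walk-□ˡ here       = here
walk-□ˡ (step a W) = step (inj₁ (refl , a)) (walk-□ˡ W)

walk-□-split : {G H : Graph} {g g′ : V G} {h h′ : V H} {ℓ : ℕ} → Walk (G □ H) (g , h) (g′ , h′) ℓ →
               ∃ λ ℓ₁ → ∃ λ ℓ₂ → ℓ₁ + ℓ₂ ≡ ℓ × Walk G g g′ ℓ₁ × Walk H h h′ ℓ₂
walk-□-split here = 0 , 0 , refl , here , here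
walk-□-split {G = G} {H} (step {w = _ , _} (inj₁ (refl , a)) W) with walk-□-split {G = G} {H} W
... | ℓ₁ , ℓ₂ , eq , W₁ , W₂ = suc ℓ₁ , ℓ₂ , cong suc eq , step a W₁ , W₂
walk-□-split {G = G} {H} (step {w = _ , _} (inj₂ (refl , a)) W) with walk-□-split {G = G} {H} W
... | ℓ₁ , ℓ₂ , eq , W₁ , W₂ = ℓ₁ , suc ℓ₂ , trans (ℕ.+-suc ℓ₁ ℓ₂) (cong suc eq) , W₁ , step a W₂

walk-between-distinct : {G : Graph} {u v : V G} {ℓ : ℕ} → u ≢ v → Walk G u v ℓ → 0 < ℓ
walk-between-distinct u≢u here       = contradiction refl u≢u
walk-between-distinct _   (step _ _) = s≤s z≤n

-- Weights and the lower bound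

weight : Fin 3 → Fin 3 → ℕ
weight _    zero    = 0
weight zero (suc _) = 1
weight 𝟙    𝟙       = 2
weight 𝟙    𝟚       = 1
weight 𝟚    𝟙       = 1
weight 𝟚    𝟚       = 2

weight-lipschitz : ∀ d a b → weight d a + weight d b ≤ 3 + (weight d (a -₃ 𝟙) + weight d (b -₃ 𝟚))
weight-lipschitz = from-yes (all? λ d → all? λ a → all? λ b →
  weight d a + weight d b ≤? 3 + (weight d (a -₃ 𝟙) + weight d (b -₃ 𝟚)))

weight-self : ∀ d → d ≢ zero → weight d d ≡ 2
weight-self = from-yes (all? λ d → ¬? (d ≟ zero) →-dec (weight d d ℕ.≟ 2))

weight-zero≤1 : ∀ a → weight zero a ≤ 1
weight-zero≤1 zero    = z≤n
weight-zero≤1 (suc _) = s≤s z≤n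

Φ : Fin 3 → Vec₃ m → ℕ
Φ d []      = 0
Φ d (a ∷ w) = weight d a + Φ d w

hamming : Vec₃ m → ℕ
hamming = Φ zero

Φ-replicate : ∀ d m a → Φ d (replicate m a) ≡ m * weight d a
Φ-replicate d zero    a = refl
Φ-replicate d (suc m) a = cong (weight d a +_) (Φ-replicate d m a)

Φ-[]≔ : ∀ d (w : Vec₃ m) i a → Φ d (w [ i ]≔ a) + weight d (lookup w i) ≡ Φ d w + weight d a
Φ-[]≔ d (b ∷ w) zero    a = swap (weight d a) (Φ d w) (weight d b)
  where
  swap : ∀ p q r → (p + q) + r ≡ (r + q) + p
  swap = solve-∀
Φ-[]≔ d (b ∷ w) (suc i) a = begin
  (weight d b + Φ d (w [ i ]≔ a)) + weight d (lookup w i) ≡⟨ ℕ.+-assoc (weight d b) _ _ ⟩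
  weight d b + (Φ d (w [ i ]≔ a) + weight d (lookup w i)) ≡⟨ cong (weight d b +_) (Φ-[]≔ d w i a) ⟩
  weight d b + (Φ d w + weight d a)                       ≡⟨ ℕ.+-assoc (weight d b) _ _ ⟨
  (weight d b + Φ d w) + weight d a                       ∎
  where open ≡-Reasoning

⊖x≡[]≔ : (w : Vec₃ m) {i j : Fin m} → i ≢ j →
         w ⊖ x i j ≡ (w [ i ]≔ (lookup w i -₃ 𝟙)) [ j ]≔ (lookup w j -₃ 𝟚)
⊖x≡[]≔ w {i} {j} i≢j = ≡-by-lookup at
  where
  w′ = w [ i ]≔ (lookup w i -₃ 𝟙)
  at : ∀ k → lookup (w ⊖ x i j) k ≡ lookup (w′ [ j ]≔ (lookup w j -₃ 𝟚)) k
  at k with k ≟ j | k ≟ i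
  ... | yes refl | _        = trans (lookup-⊖ w (x i j) k)
                                (trans (cong (lookup w k -₃_) (lookup-x-at-j i k i≢j)) (sym (lookup∘update k w′ _)))
  ... | no k≢j   | yes refl = trans (lookup-⊖ w (x i j) k)
                                (trans (cong (lookup w k -₃_) (lookup-x-at-i k j))
                                  (sym (trans (lookup∘update′ k≢j w′ _) (lookup∘update k w _))))
  ... | no k≢j   | no k≢i   = trans (lookup-⊖ w (x i j) k)
                                (trans (cong (lookup w k -₃_) (lookup-x-elsewhere i j k k≢i k≢j))
                                  (trans (-₃-identityʳ (lookup w k))
                                    (sym (trans (lookup∘update′ k≢j w′ _) (lookup∘update′ k≢i w _)))))

Φ-⊖x : ∀ d (w : Vec₃ m) {i j : Fin m} → i ≢ j →
       Φ d w + (weight d (lookup w i -₃ 𝟙) + weight d (lookup w j -₃ 𝟚)) ≡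
       Φ d (w ⊖ x i j) + (weight d (lookup w i) + weight d (lookup w j))
Φ-⊖x d w {i} {j} i≢j = begin
  Φ d w + (a′ + b′)          ≡⟨ ℕ.+-assoc (Φ d w) a′ b′ ⟨
  (Φ d w + a′) + b′          ≡⟨ cong (_+ b′) (Φ-[]≔ d w i _) ⟨
  (Φ d w₁ + a) + b′          ≡⟨ shuffle (Φ d w₁) a b′ ⟩
  (Φ d w₁ + b′) + a          ≡⟨ cong (_+ a) (Φ-[]≔ d w₁ j _) ⟨
  (Φ d w₂ + weight d (lookup w₁ j)) + a
                             ≡⟨ cong (λ c → (Φ d w₂ + weight d c) + a) (lookup∘update′ (i≢j ∘ sym) w _) ⟩
  (Φ d w₂ + b) + a           ≡⟨ shuffle′ (Φ d w₂) b a ⟩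
  Φ d w₂ + (a + b)           ≡⟨ cong (λ v → Φ d v + (a + b)) (⊖x≡[]≔ w i≢j) ⟨
  Φ d (w ⊖ x i j) + (a + b)  ∎
  where
  open ≡-Reasoning
  a = weight d (lookup w i)
  b = weight d (lookup w j)
  a′ = weight d (lookup w i -₃ 𝟙)
  b′ = weight d (lookup w j -₃ 𝟚)
  w₁ = w [ i ]≔ (lookup w i -₃ 𝟙)
  w₂ = w₁ [ j ]≔ (lookup w j -₃ 𝟚)
  shuffle : ∀ p q r → (p + q) + r ≡ (p + r) + q
  shuffle = solve-∀
  shuffle′ : ∀ p q r → (p + q) + r ≡ p + (r + q)
  shuffle′ = solve-∀

Φ-⊖x-≤ : ∀ d (w : Vec₃ m) {i j : Fin m} → i ≢ j → Φ d w ≤ 3 + Φ d (w ⊖ x i j)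
Φ-⊖x-≤ d w {i} {j} i≢j = ℕ.+-cancelʳ-≤ (a′ + b′) (Φ d w) (3 + Φ d (w ⊖ x i j)) (begin
  Φ d w + (a′ + b′)                   ≡⟨ Φ-⊖x d w i≢j ⟩
  Φ d (w ⊖ x i j) + (a + b)           ≤⟨ ℕ.+-monoʳ-≤ _ (weight-lipschitz d (lookup w i) (lookup w j)) ⟩
  Φ d (w ⊖ x i j) + (3 + (a′ + b′))   ≡⟨ ℕ.+-assoc (Φ d (w ⊖ x i j)) 3 _ ⟨
  (Φ d (w ⊖ x i j) + 3) + (a′ + b′)   ≡⟨ cong (_+ (a′ + b′)) (ℕ.+-comm (Φ d (w ⊖ x i j)) 3) ⟩
  (3 + Φ d (w ⊖ x i j)) + (a′ + b′)   ∎)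
  where
  open ℕ.≤-Reasoning
  a = weight d (lookup w i)
  b = weight d (lookup w j)
  a′ = weight d (lookup w i -₃ 𝟙)
  b′ = weight d (lookup w j -₃ 𝟚)

Φ-⊖-self : ∀ d (u : Vec₃ m) → Φ d (u ⊖ u) ≡ 0
Φ-⊖-self d []      = refl
Φ-⊖-self d (a ∷ u) = cong₂ _+_ (cong (weight d) (-₃-self a)) (Φ-⊖-self d u)

Φ-walk : ∀ d {y z : Γ m} {ℓ} → Walk (Gm m) y z ℓ → Φ d (diff y z) ≤ 3 * ℓ
Φ-walk d {y} here = ℕ.≤-reflexive (Φ-⊖-self d (proj₁ y))
Φ-walk d {y} {z} (step {w = y′} {ℓ = ℓ} (i , j , i≢j , y−y′≡x) W) = begin
  Φ d (diff y z)                    ≤⟨ Φ-⊖x-≤ d (diff y z) i≢j ⟩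
  3 + Φ d (diff y z ⊖ x i j)        ≡⟨ cong (λ v → 3 + Φ d (diff y z ⊖ v)) y−y′≡x ⟨
  3 + Φ d (diff y z ⊖ diff y y′)    ≡⟨ cong (λ v → 3 + Φ d v) (diff-step y y′ z) ⟨
  3 + Φ d (diff y′ z)               ≤⟨ ℕ.+-monoʳ-≤ 3 (Φ-walk d W) ⟩
  3 + 3 * ℓ                         ≡⟨ ℕ.*-suc 3 ℓ ⟨
  3 * suc ℓ                         ∎
  where open ℕ.≤-Reasoning

hamming≤ : (w : Vec₃ m) → hamming w ≤ m
hamming≤ []      = z≤n
hamming≤ (a ∷ w) = ℕ.+-mono-≤ (weight-zero≤1 a) (hamming≤ w)

hamming< : (w : Vec₃ m) → Has zero w → hamming w < m
hamming< (a ∷ w) (zero  , refl) = s≤s (hamming≤ w)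
hamming< (a ∷ w) (suc k , wk≡0) = begin-strict
  weight zero a + hamming w  <⟨ ℕ.+-monoʳ-< (weight zero a) (hamming< w (k , wk≡0)) ⟩
  weight zero a + _          ≤⟨ ℕ.+-monoˡ-≤ _ (weight-zero≤1 a) ⟩
  suc _                      ∎
  where open ℕ.≤-Reasoning

hamming-⊖x : (w : Vec₃ m) {i j : Fin m} → i ≢ j → ∀ {a b} → lookup w i ≡ a → lookup w j ≡ b →
             hamming w + (weight zero (a -₃ 𝟙) + weight zero (b -₃ 𝟚)) ≡
             hamming (w ⊖ x i j) + (weight zero a + weight zero b)
hamming-⊖x w i≢j refl refl = Φ-⊖x zero w i≢j

hamming-pair : (w : Vec₃ m) {i j : Fin m} (i≢j : i ≢ j) → lookup w i ≡ 𝟙 → lookup w j ≡ 𝟚 →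
               hamming w ≡ 2 + hamming (w ⊖ x i j)
hamming-pair w i≢j wi wj =
  trans (sym (ℕ.+-identityʳ _)) (trans (hamming-⊖x w i≢j wi wj) (ℕ.+-comm _ 2))

hamming-equal : (w : Vec₃ m) {i j : Fin m} (i≢j : i ≢ j) {a : Fin 3} → a ≢ zero →
                lookup w i ≡ a → lookup w j ≡ a → hamming w ≡ 1 + hamming (w ⊖ x i j)
hamming-equal w i≢j {zero} a≢0 _  _  = contradiction refl a≢0
hamming-equal w i≢j {𝟙}    _   wi wj =
  ℕ.suc-injective (trans (ℕ.+-comm 1 _) (trans (hamming-⊖x w i≢j wi wj) (ℕ.+-comm _ 2)))
hamming-equal w i≢j {𝟚}    _   wi wj =
  ℕ.suc-injective (trans (ℕ.+-comm 1 _) (trans (hamming-⊖x w i≢j wi wj) (ℕ.+-comm _ 2)))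

-- Short walks in G_m

record Route (w : Vec₃ m) : Set where
  field
    length : ℕ
    walks  : {y z : Γ m} → diff y z ≡ w → Walk (Gm m) y z length
    bound  : 3 * length ≤ 2 * hamming w
    strict : Has 𝟙 w → Has 𝟚 w → 3 * length < 2 * hamming w

walks-⊖x : {w : Vec₃ m} {i j : Fin m} (i≢j : i ≢ j) {ℓ : ℕ} →
           ({y z : Γ m} → diff y z ≡ w ⊖ x i j → Walk (Gm m) y z ℓ) →
           {y z : Γ m} → diff y z ≡ w → Walk (Gm m) y z (suc ℓ)
walks-⊖x {i = i} {j} i≢j walks {y} {z} y−z≡w =
  step {w = y − X i≢j} (i , j , i≢j , diff-− y (X i≢j))
       (walks (trans (diff-step y (y − X i≢j) z) (cong₂ _⊖_ y−z≡w (diff-− y (X i≢j)))))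

pair-bound : ∀ ℓ N → 3 * ℓ ≤ 2 * N → 3 * suc ℓ < 2 * (2 + N)
pair-bound ℓ N h rewrite ℕ.*-suc 3 ℓ | ℕ.*-distribˡ-+ 2 2 N = s≤s (s≤s (s≤s (s≤s h)))

triple-bound : ∀ ℓ N → 3 * ℓ < 2 * N → 3 * suc ℓ ≤ 2 * (1 + N)
triple-bound ℓ N h rewrite ℕ.*-suc 3 ℓ | ℕ.*-distribˡ-+ 2 1 N = s≤s (s≤s h)

route-zero : (w : Vec₃ m) → (∀ k → lookup w k ≡ zero) → Route w
route-zero w zeros = record
  { length = 0
  ; walks  = λ {y} {z} y−z≡w →
      subst (λ z′ → Walk (Gm _) y z′ 0) (Γ-≡ (⊖≡0⇒≡ (proj₁ y) (proj₁ z) (trans y−z≡w w≡0))) here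
  ; bound  = z≤n
  ; strict = λ (k , wk≡1) _ → contradiction (trans (sym wk≡1) (zeros k)) λ ()
  }
  where
  w≡0 : w ≡ replicate _ zero
  w≡0 = ≡-by-lookup λ k → trans (zeros k) (sym (lookup-replicate k zero))

route-pair : (w : Vec₃ m) {i j : Fin m} (i≢j : i ≢ j) → lookup w i ≡ 𝟙 → lookup w j ≡ 𝟚 →
             Route (w ⊖ x i j) → Route w
route-pair w i≢j wi wj r = record
  { length = suc length
  ; walks  = walks-⊖x i≢j walks
  ; bound  = ℕ.<⇒≤ strict′
  ; strict = λ _ _ → strict′
  }
  where
  open Route r
  strict′ : 3 * suc length < 2 * hamming w
  strict′ = subst (λ N → 3 * suc length < 2 * N) (sym (hamming-pair w i≢j wi wj)) (pair-bound length _ bound)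

-- With a single nonzero value present, one generator creates the other value while a copy of the
-- first survives (the sum is zero), so the strict bound of the remaining route pays for this step.
route-ones : (w : Vec₃ m) → sum₃ w ≡ zero → ¬ Has 𝟚 w → {i j : Fin m} (i≢j : i ≢ j) →
             lookup w i ≡ 𝟙 → lookup w j ≡ 𝟙 → Route (w ⊖ x i j) → Route w
route-ones w Σw ∄2 {i} {j} i≢j wi wj r = record
  { length = suc length
  ; walks  = walks-⊖x i≢j walks
  ; bound  = subst (λ N → 3 * suc length ≤ 2 * N) (sym (hamming-equal w i≢j (λ ()) wi wj))
                   (triple-bound length _ (strict has𝟙 (j , w′j≡2)))
  ; strict = λ _ has𝟚 → contradiction has𝟚 ∄2
  }
  where
  open Route r
  w′ = w ⊖ x i j
  w′i≡0 : lookup w′ i ≡ zero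
  w′i≡0 = trans (lookup-⊖x-at-i w i j) (cong (_-₃ 𝟙) wi)
  w′j≡2 : lookup w′ j ≡ 𝟚
  w′j≡2 = trans (lookup-⊖x-at-j w i j i≢j) (cong (_-₃ 𝟚) wj)
  has𝟙 : Has 𝟙 w′
  has𝟙 with nonzero-elsewhere w′ j (λ e → contradiction (trans (sym (sum₃-⊖x w i≢j Σw)) (trans e w′j≡2)) λ ())
  ... | k , k≢j , w′k≢0 with k ≟ i
  ...   | yes refl = contradiction w′i≡0 w′k≢0
  ...   | no k≢i   = k , only-𝟙 _ w′k≢0 λ w′k≡2 →
                       ∄2 (k , trans (sym (lookup-⊖x-elsewhere w i j k k≢i k≢j)) w′k≡2)

route-twos : (w : Vec₃ m) → sum₃ w ≡ zero → ¬ Has 𝟙 w → {i j : Fin m} (i≢j : i ≢ j) →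
             lookup w i ≡ 𝟚 → lookup w j ≡ 𝟚 → Route (w ⊖ x i j) → Route w
route-twos w Σw ∄1 {i} {j} i≢j wi wj r = record
  { length = suc length
  ; walks  = walks-⊖x i≢j walks
  ; bound  = subst (λ N → 3 * suc length ≤ 2 * N) (sym (hamming-equal w i≢j (λ ()) wi wj))
                   (triple-bound length _ (strict (i , w′i≡1) has𝟚))
  ; strict = λ has𝟙 _ → contradiction has𝟙 ∄1
  }
  where
  open Route r
  w′ = w ⊖ x i j
  w′i≡1 : lookup w′ i ≡ 𝟙
  w′i≡1 = trans (lookup-⊖x-at-i w i j) (cong (_-₃ 𝟙) wi)
  w′j≡0 : lookup w′ j ≡ zero
  w′j≡0 = trans (lookup-⊖x-at-j w i j i≢j) (cong (_-₃ 𝟚) wj)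
  has𝟚 : Has 𝟚 w′
  has𝟚 with nonzero-elsewhere w′ i (λ e → contradiction (trans (sym (sum₃-⊖x w i≢j Σw)) (trans e w′i≡1)) λ ())
  ... | k , k≢i , w′k≢0 with k ≟ j
  ...   | yes refl = contradiction w′j≡0 w′k≢0
  ...   | no k≢j   = k , only-𝟚 _ w′k≢0 λ w′k≡1 →
                       ∄1 (k , trans (sym (lookup-⊖x-elsewhere w i j k k≢i k≢j)) w′k≡1)

route : (w : Vec₃ m) → sum₃ w ≡ zero → Acc _<_ (hamming w) → Route w
route w Σw (acc rec) with has? 𝟙 w | has? 𝟚 w
... | no ∄1 | no ∄2 = route-zero w λ k → only-zero _ (∄1 ∘ (k ,_)) (∄2 ∘ (k ,_))
... | yes (i , wi) | yes (j , wj) =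
  route-pair w i≢j wi wj (route (w ⊖ x i j) (sum₃-⊖x w i≢j Σw) (rec smaller))
  where
  i≢j : i ≢ j
  i≢j refl = contradiction (trans (sym wi) wj) λ ()
  smaller : hamming (w ⊖ x i j) < hamming w
  smaller = subst (hamming (w ⊖ x i j) <_) (sym (hamming-pair w i≢j wi wj)) (s≤s (ℕ.n≤1+n _))
... | yes (i , wi) | no ∄2 with nonzero-elsewhere w i (λ e → contradiction (trans (sym Σw) (trans e wi)) λ ())
...   | j , j≢i , wj≢0 =
  route-ones w Σw ∄2 j≢i wj wi (route (w ⊖ x j i) (sum₃-⊖x w j≢i Σw) (rec smaller))
  where
  wj : lookup w j ≡ 𝟙
  wj = only-𝟙 _ wj≢0 (∄2 ∘ (j ,_))
  smaller : hamming (w ⊖ x j i) < hamming w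
  smaller = subst (hamming (w ⊖ x j i) <_) (sym (hamming-equal w j≢i (λ ()) wj wi)) (ℕ.n<1+n _)
route w Σw (acc rec) | no ∄1 | yes (i , wi)
  with nonzero-elsewhere w i (λ e → contradiction (trans (sym Σw) (trans e wi)) λ ())
...   | j , j≢i , wj≢0 =
  route-twos w Σw ∄1 j≢i wj wi (route (w ⊖ x j i) (sum₃-⊖x w j≢i Σw) (rec smaller))
  where
  wj : lookup w j ≡ 𝟚
  wj = only-𝟚 _ wj≢0 (∄1 ∘ (j ,_))
  smaller : hamming (w ⊖ x j i) < hamming w
  smaller = subst (hamming (w ⊖ x j i) <_) (sym (hamming-equal w j≢i (λ ()) wj wi)) (ℕ.n<1+n _)

module _ {w : Vec₃ m} (r : Route w) where
  open Route r

  route-≤ : 3 * length ≤ 2 * m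
  route-≤ = ℕ.≤-trans bound (ℕ.*-monoʳ-≤ 2 (hamming≤ w))

  route-< : (∀ d → d ≢ zero → w ≢ replicate m d) → 3 * length < 2 * m
  route-< nonconstant with zero-or-mixed-or-constant w
  ... | inj₁ has0                   = ℕ.≤-<-trans bound (ℕ.*-monoʳ-< 2 (hamming< w has0))
  ... | inj₂ (inj₁ (has1 , has2))   = ℕ.<-≤-trans (strict has1 has2) (ℕ.*-monoʳ-≤ 2 (hamming≤ w))
  ... | inj₂ (inj₂ (d , d≢0 , w≡d)) = contradiction w≡d (nonconstant d d≢0)

-- Distances in H_m

2m≡3[2n] : ∀ n → m ≡ 3 * n → 2 * m ≡ 3 * (2 * n)
2m≡3[2n] n refl = trans (sym (ℕ.*-assoc 2 3 n)) (ℕ.*-assoc 3 2 n)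

module _ (n : ℕ) (m≡3n : m ≡ 3 * n) (y z : Γ m) (s t : Fin 3) where

  private
    r : Route (diff y z)
    r = route (diff y z) (sum₃-diff y z) (<-wellFounded _)
    open Route r

  dist-upper : (∀ d → diff y z ≡ replicate m d → d ≡ zero ⊎ s ≡ t) →
               Dist≤ (Hm m) (2 * n) (y , s) (z , t)
  dist-upper constant⇒ with s ≟ t
  ... | yes refl = length , ℕ.*-cancelˡ-≤ 3 (subst (3 * length ≤_) (2m≡3[2n] n m≡3n) (route-≤ r)) ,
                   walk-□ˡ (walks refl)
  ... | no s≢t   = suc length ,
                   ℕ.*-cancelˡ-< 3 length (2 * n) (subst (3 * length <_) (2m≡3[2n] n m≡3n) (route-< r nonconstant)) ,
                   step (inj₂ (refl , s≢t)) (walk-□ˡ (walks refl))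
    where
    nonconstant : ∀ d → d ≢ zero → diff y z ≢ replicate m d
    nonconstant d d≢0 y−z≡d with constant⇒ d y−z≡d
    ... | inj₁ d≡0 = d≢0 d≡0
    ... | inj₂ s≡t = s≢t s≡t

  dist-lower : Dist≤ (Hm m) (2 * n) (y , s) (z , t) →
               ∀ d → diff y z ≡ replicate m d → d ≡ zero ⊎ s ≡ t
  dist-lower (ℓ , ℓ≤2n , W) d y−z≡d with d ≟ zero | s ≟ t | walk-□-split W
  ... | yes d≡0 | _       | _ = inj₁ d≡0
  ... | no _    | yes s≡t | _ = inj₂ s≡t
  ... | no d≢0  | no s≢t  | ℓ₁ , ℓ₂ , ℓ₁+ℓ₂≡ℓ , W₁ , W₂ = contradiction ℓ≤2n (ℕ.<⇒≱ (begin-strict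
    2 * n    ≤⟨ ℕ.*-cancelˡ-≤ 3 (begin
                  3 * (2 * n)          ≡⟨ 2m≡3[2n] n m≡3n ⟨
                  2 * m                ≡⟨ ℕ.*-comm 2 m ⟩
                  m * 2                ≡⟨ cong (m *_) (weight-self d d≢0) ⟨
                  m * weight d d       ≡⟨ Φ-replicate d m d ⟨
                  Φ d (replicate m d)  ≡⟨ cong (Φ d) y−z≡d ⟨
                  Φ d (diff y z)       ≤⟨ Φ-walk d W₁ ⟩
                  3 * ℓ₁               ∎) ⟩
    ℓ₁       <⟨ ℕ.m<m+n ℓ₁ (walk-between-distinct s≢t W₂) ⟩
    ℓ₁ + ℓ₂  ≡⟨ ℓ₁+ℓ₂≡ℓ ⟩
    ℓ        ∎))
    where open ℕ.≤-Reasoning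

-- Classes modulo the all-ones vector

-- y ↦ (class y , head y) identifies Γ (2 + k) with ℤ₃ᵏ × ℤ₃ (the zero sum fixes y₂); when 3 divides
-- 2 + k, y − z is constant exactly when class y ≡ class z.
class : Vec₃ (2 + k) → Vec₃ k
class (a ∷ _ ∷ r) = map (_-₃ a) r

module _ (sum₃-replicate : ∀ d → sum₃ (replicate (2 + k) d) ≡ zero) where

  class≡⇒diff≡replicate : (y z : Γ (2 + k)) → class (proj₁ y) ≡ class (proj₁ z) →
                          diff y z ≡ replicate (2 + k) (head (proj₁ y) -₃ head (proj₁ z))
  class≡⇒diff≡replicate y@(a ∷ b ∷ r , _) z@(a′ ∷ b′ ∷ r′ , _) r-a≡r′-a′ =
    cong (d ∷_) (cong₂ _∷_ b-b′≡d r⊖r′≡d)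
    where
    d = a -₃ a′
    r⊖r′≡d : r ⊖ r′ ≡ replicate k d
    r⊖r′≡d = ≡-by-lookup λ q → begin
      lookup (r ⊖ r′) q            ≡⟨ lookup-⊖ r r′ q ⟩
      lookup r q -₃ lookup r′ q    ≡⟨ -₃-exchange _ a _ a′ (begin
        lookup r q -₃ a              ≡⟨ lookup-map q (_-₃ a) r ⟨
        lookup (map (_-₃ a) r) q     ≡⟨ cong (λ c → lookup c q) r-a≡r′-a′ ⟩
        lookup (map (_-₃ a′) r′) q   ≡⟨ lookup-map q (_-₃ a′) r′ ⟩
        lookup r′ q -₃ a′            ∎) ⟩
      d                            ≡⟨ lookup-replicate q d ⟨
      lookup (replicate k d) q     ∎
      where open ≡-Reasoning
    b-b′≡d : b -₃ b′ ≡ d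
    b-b′≡d = +₃-cancel-middle d (b -₃ b′) (sum₃ (replicate k d))
      (subst (λ v → d +₃ ((b -₃ b′) +₃ sum₃ v) ≡ zero) r⊖r′≡d (sum₃-diff y z))
      (sum₃-replicate d)

  diff≡replicate⇒class≡ : (y z : Γ (2 + k)) {d : Fin 3} → diff y z ≡ replicate (2 + k) d →
                          class (proj₁ y) ≡ class (proj₁ z)
  diff≡replicate⇒class≡ (a ∷ b ∷ r , _) (a′ ∷ b′ ∷ r′ , _) {d} y−z≡d = ≡-by-lookup λ q → begin
    lookup (map (_-₃ a) r) q     ≡⟨ lookup-map q (_-₃ a) r ⟩
    lookup r q -₃ a              ≡⟨ -₃-exchange _ _ a a′ (begin
      lookup r q -₃ lookup r′ q    ≡⟨ lookup-⊖ r r′ q ⟨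
      lookup (r ⊖ r′) q            ≡⟨ cong (λ v → lookup (tail (tail v)) q) y−z≡d ⟩
      lookup (replicate k d) q     ≡⟨ lookup-replicate q d ⟩
      d                            ≡⟨ cong head y−z≡d ⟨
      a -₃ a′                      ∎) ⟩
    lookup r′ q -₃ a′            ≡⟨ lookup-map q (_-₃ a′) r′ ⟨
    lookup (map (_-₃ a′) r′) q   ∎
    where open ≡-Reasoning

Vec↔Fin^ : ∀ {n} k → Vec (Fin n) k ↔ Fin (n ^ k)
Vec↔Fin^ {n} k = mk↔ₛ′ encode (decode k) (encode∘decode k) decode∘encode
  where
  encode : ∀ {k} → Vec (Fin n) k → Fin (n ^ k)
  encode []      = zero
  encode (a ∷ v) = combine a (encode v)
  decode : ∀ k → Fin (n ^ k) → Vec (Fin n) k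
  decode zero    _ = []
  decode (suc k) i = proj₁ (remQuot {n} (n ^ k) i) ∷ decode k (proj₂ (remQuot {n} (n ^ k) i))
  encode∘decode : ∀ k i → encode (decode k i) ≡ i
  encode∘decode zero    zero = refl
  encode∘decode (suc k) i    =
    trans (cong (combine {n} (proj₁ (remQuot {n} (n ^ k) i))) (encode∘decode k _)) (combine-remQuot {n} (n ^ k) i)
  decode∘encode : ∀ {k} v → decode k (encode v) ≡ v
  decode∘encode []              = refl
  decode∘encode {suc k} (a ∷ v) =
    trans (cong (λ p → proj₁ p ∷ decode k (proj₂ p)) (remQuot-combine {k = n ^ k} a (encode v)))
          (cong (a ∷_) (decode∘encode v))

Γ↔class×head : Γ (2 + k) ↔ (Vec₃ k × Fin 3)
Γ↔class×head {k} = mk↔ₛ′ to from to∘from from∘to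
  where
  to : Γ (2 + k) → Vec₃ k × Fin 3
  to (y , _) = class y , head y
  from : Vec₃ k × Fin 3 → Γ (2 + k)
  from (c , a) = (a ∷ neg₃ (a +₃ sum₃ (map (_+₃ a) c)) ∷ map (_+₃ a) c) , neg₃-solves a _
  map-cancel : ∀ {f g : Fin 3 → Fin 3} → (∀ b → f (g b) ≡ b) → (c : Vec₃ k) → map f (map g c) ≡ c
  map-cancel f∘g c = trans (sym (map-∘ _ _ c)) (trans (map-cong f∘g c) (map-id c))
  to∘from : ∀ p → to (from p) ≡ p
  to∘from (c , a) = cong (_, a) (map-cancel (λ b → -₃-+₃-cancel b a) c)
  from∘to : ∀ y → from (to y) ≡ y
  from∘to (a ∷ b ∷ r , Σy) = Γ-≡ (cong (a ∷_) (cong₂ _∷_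
    (trans (cong (λ v → neg₃ (a +₃ sum₃ v)) r≡) (sym (neg₃-solves-unique a b (sum₃ r) Σy))) r≡))
    where
    r≡ : map (_+₃ a) (map (_-₃ a) r) ≡ r
    r≡ = map-cancel (λ b → +₃--₃-cancel b a) r

vertex↔ : (Γ (2 + k) × Fin 3) ↔ (Fin (3 ^ k) × Fin 3 × Fin 3)
vertex↔ {k} = ↔-trans (×-cong Γ↔class×head ↔-refl) (↔-trans (×-assoc 0ℓ _ _ _) (×-cong (Vec↔Fin^ k) ↔-refl))

Adj-lex-rook⇔ : ∀ {r p q} (c c′ : Fin r) (a a′ : Fin p) (s t : Fin q) →
  Adj (lex (K r) (K p □ K q)) (c , a , s) (c′ , a′ , t) ⇔
  ((c , a , s) ≢ (c′ , a′ , t) × (c ≡ c′ → a ≡ a′ ⊎ s ≡ t))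
Adj-lex-rook⇔ {r} {p} {q} c c′ a a′ s t = mk⇔ to from
  where
  to : Adj (lex (K r) (K p □ K q)) (c , a , s) (c′ , a′ , t) →
       (c , a , s) ≢ (c′ , a′ , t) × (c ≡ c′ → a ≡ a′ ⊎ s ≡ t)
  to (inj₁ c≢c′)                       = c≢c′ ∘ cong proj₁ , λ c≡c′ → contradiction c≡c′ c≢c′
  to (inj₂ (_ , inj₁ (s≡t , a≢a′)))    = a≢a′ ∘ cong (proj₁ ∘ proj₂) , λ _ → inj₂ s≡t
  to (inj₂ (_ , inj₂ (a≡a′ , s≢t)))    = s≢t ∘ cong (proj₂ ∘ proj₂) , λ _ → inj₁ a≡a′
  from : (c , a , s) ≢ (c′ , a′ , t) × (c ≡ c′ → a ≡ a′ ⊎ s ≡ t) →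
         Adj (lex (K r) (K p □ K q)) (c , a , s) (c′ , a′ , t)
  from (distinct , same-class⇒) with c ≟ c′
  ... | no c≢c′ = inj₁ c≢c′
  ... | yes refl with same-class⇒ refl
  ...   | inj₁ refl = inj₂ (refl , inj₂ (refl , λ { refl → distinct refl }))
  ...   | inj₂ refl = inj₂ (refl , inj₁ (refl , λ { refl → distinct refl }))

module _ (n : ℕ) (2+k≡3n : 2 + k ≡ 3 * n) where

  sum₃-replicate : ∀ d → sum₃ (replicate (2 + k) d) ≡ zero
  sum₃-replicate d = subst (λ l → sum₃ (replicate l d) ≡ zero) (sym 2+k≡3n) (sum₃-replicate-3n n d)

  dist≤⇔ : (y z : Γ (2 + k)) (s t : Fin 3) →
           Dist≤ (Hm (2 + k)) (2 * n) (y , s) (z , t) ⇔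
           (class (proj₁ y) ≡ class (proj₁ z) → head (proj₁ y) ≡ head (proj₁ z) ⊎ s ≡ t)
  dist≤⇔ y@(a ∷ _ , _) z@(_ ∷ _ , _) s t = mk⇔ to from
    where
    to : Dist≤ (Hm (2 + k)) (2 * n) (y , s) (z , t) →
         class (proj₁ y) ≡ class (proj₁ z) → head (proj₁ y) ≡ head (proj₁ z) ⊎ s ≡ t
    to D same-class with dist-lower n 2+k≡3n y z s t D _ (class≡⇒diff≡replicate sum₃-replicate y z same-class)
    ... | inj₁ a-a′≡0 = inj₁ (-₃≡0⇒≡ _ _ a-a′≡0)
    ... | inj₂ s≡t    = inj₂ s≡t
    from : (class (proj₁ y) ≡ class (proj₁ z) → head (proj₁ y) ≡ head (proj₁ z) ⊎ s ≡ t) →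
           Dist≤ (Hm (2 + k)) (2 * n) (y , s) (z , t)
    from same-class⇒ = dist-upper n 2+k≡3n y z s t λ d y−z≡d →
      map₁ (λ a≡a′ → trans (sym (cong head y−z≡d)) (trans (cong (a -₃_) (sym a≡a′)) (-₃-self a)))
           (same-class⇒ (diff≡replicate⇒class≡ sum₃-replicate y z y−z≡d))

  Hm^2n≅ : (Hm (2 + k) ^^ (2 * n)) ≅ lex (K (3 ^ k)) (K 3 □ K 3)
  Hm^2n≅ = ↔⇒⤖ vertex↔ , Adj⇔
    where
    injective⇔ : {A B : Set} (f : A ↔ B) {a a′ : A} → (a ≡ a′) ⇔ (Inverse.to f a ≡ Inverse.to f a′)
    injective⇔ f = mk⇔ (cong (Inverse.to f)) (Bijection.injective (↔⇒⤖ f))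
    Adj⇔ : ∀ u v → Adj (Hm (2 + k) ^^ (2 * n)) u v ⇔
                   Adj (lex (K (3 ^ k)) (K 3 □ K 3)) (Inverse.to vertex↔ u) (Inverse.to vertex↔ v)
    Adj⇔ (y , s) (z , t) = ⇔-trans
      (¬-cong-⇔ (injective⇔ vertex↔)
        ×-⇔ ⇔-trans (dist≤⇔ y z s t) (→-cong-⇔ (injective⇔ (Vec↔Fin^ k)) ⇔-refl))
      (⇔-sym (Adj-lex-rook⇔ _ _ _ _ s t))

theorem4 : (n : ℕ) → 1 ≤ n →
    (Hm (3 * n) ^^ (2 * n)) ≅ lex (K (3 ^ (3 * n ∸ 2))) (K 3 □ K 3)
theorem4 n 1≤n =
  subst (λ m → (Hm m ^^ (2 * n)) ≅ lex (K (3 ^ (3 * n ∸ 2))) (K 3 □ K 3)) 2+k≡3n (Hm^2n≅ n 2+k≡3n)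
  where
  2+k≡3n : 2 + (3 * n ∸ 2) ≡ 3 * n
  2+k≡3n = ℕ.m+[n∸m]≡n {2} (ℕ.≤-trans (ℕ.n≤1+n 2) (ℕ.*-monoʳ-≤ 3 1≤n))
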